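{- Let $G\in\mathcal{G}$ be a simple graph with $\delta=\delta(G)$. Then for each integer $i>0$: (i) if $\delta\ge 3$, then $L^i(G)$ is $2^{i-1}(\delta-2)$-triangular; (ii) if $\delta\le 2$, then $L^{\widetilde d(G)+i}(G)$ is $2^{i-1}(\delta_0-2)$-triangular, where $\delta_0=\delta(L^{\widetilde d(G)}(G))$; in particular, $L^{\widetilde d(G)+i}(G)$ is $2^{i-1}$-triangular.
   Context: Graphs are finite and loopless (parallel edges allowed); a simple graph has no parallel edges. $\delta(G)$ is the minimum degree. The line graph $L(G)$ is the simple graph with vertex set $E(G)$, two vertices adjacent iff the edges share an end vertex; $L^0(G)=G$, $L^i(G)=L(L^{i-1}(G))$. Let $J_1$ (resp. $J_2$) be obtained from $K_{1,3}$ by identifying two (resp. all three) of its degree-1 vertices. $\mathcal{G}$ is the family of connected graphs not isomorphic to a path, a cycle, $K_{1,3}$, $J_1$ or $J_2$. $\widetilde d(G)=\min\{i:\delta(L^i(G))\ge 3\}$ (this exists for $G\in\mathcal{G}$). For an integer $k>0$, a graph is $k$-triangular if each of its edges lies in at least $k$ distinct triangles. -}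

module Defs where

open import Data.Nat using (ℕ; zero; suc; _+_; _∸_; _≤_; _<_; _≡ᵇ_; _<ᵇ_; _⊓_; _%_)
open import Data.Fin using (Fin; toℕ)
open import Data.Fin as F using ()
open import Data.Bool using (Bool; true; false; _∧_; _∨_; not; _xor_; if_then_else_)
open import Data.List using (List; []; _∷_; [_]; length; lookup; concatMap; map; foldr; allFin; filter)
open import Data.List as L using ()
open import Data.Product using (Σ; _×_; _,_)
open import Relation.Binary.PropositionalEquality using (_≡_)
open import Relation.Nullary using (¬_)
open import Function.Bundles using (_↔_; Inverse)

-- Graphs on vertex set Fin n with Boolean adjacency.
-- A *simple* graph is one whose adjacency is symmetric and irreflexive
-- (see IsSimple); parallel edges are not representable.

record Graph : Set where
  constructor graph
  field
    n   : ℕ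
    adj : Fin n → Fin n → Bool
open Graph public

IsSimple : Graph → Set
IsSimple G = (∀ u v → adj G u v ≡ adj G v u) × (∀ u → adj G u u ≡ false)

countFin : (k : ℕ) → (Fin k → Bool) → ℕ
countFin k p = length (filter (λ x → Data.Bool._≟_ (p x) true) (allFin k))

degree : (G : Graph) → Fin (n G) → ℕ
degree G v = countFin (n G) (adj G v)

-- minimum degree δ(G) (defined as 0 for the empty graph)
δ : Graph → ℕ
δ (graph zero a) = 0
δ (graph (suc m) a) =
  foldr _⊓_ (degree (graph (suc m) a) F.zero) (map (degree (graph (suc m) a)) (allFin (suc m)))

data Reach (G : Graph) : Fin (n G) → Fin (n G) → Set where
  here : ∀ {u} → Reach G u u
  step : ∀ {u w v} → adj G u w ≡ true → Reach G w v → Reach G u v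

Connected : Graph → Set
Connected G = (1 ≤ n G) × (∀ u v → Reach G u v)

Iso : Graph → Graph → Set
Iso G H = Σ (Fin (n G) ↔ Fin (n H)) λ f →
  ∀ u v → adj H (Inverse.to f u) (Inverse.to f v) ≡ adj G u v

Path : ℕ → Graph
Path k = graph k (λ i j → ((toℕ i + 1) ≡ᵇ toℕ j) ∨ ((toℕ j + 1) ≡ᵇ toℕ i))

Cycle : ℕ → Graph
Cycle k = graph k (λ i j → (((toℕ i + 1) % suc (k ∸ 1)) ≡ᵇ toℕ j)
                          ∨ (((toℕ j + 1) % suc (k ∸ 1)) ≡ᵇ toℕ i))

K13 : Graph
K13 = graph 4 (λ i j → (toℕ i ≡ᵇ 0) xor (toℕ j ≡ᵇ 0))

-- The family 𝒢 restricted to simple graphs: J₁ and J₂ have parallel edges,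
-- so no simple graph is isomorphic to them and that condition is vacuous here.
In𝒢 : Graph → Set
In𝒢 G = Connected G
      × (∀ k → 1 ≤ k → ¬ Iso G (Path k))
      × (∀ k → 3 ≤ k → ¬ Iso G (Cycle k))
      × ¬ Iso G K13

edges : (G : Graph) → List (Fin (n G) × Fin (n G))
edges G = concatMap (λ i → concatMap (λ j →
            if (toℕ i <ᵇ toℕ j) ∧ adj G i j then [ (i , j) ] else [])
            (allFin (n G))) (allFin (n G))

_==F_ : ∀ {k} → Fin k → Fin k → Bool
a ==F b = toℕ a ≡ᵇ toℕ b

share : ∀ {k} → Fin k × Fin k → Fin k × Fin k → Bool
share (a , b) (c , d) = (a ==F c) ∨ (a ==F d) ∨ (b ==F c) ∨ (b ==F d)

-- L(G): vertices are the edges of G (each edge listed once as (i , j), i < j),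
-- two distinct edges adjacent iff they share an end vertex.
LineGraph : Graph → Graph
LineGraph G = graph (length (edges G))
  (λ e f → not (e ==F f) ∧ share (lookup (edges G) e) (lookup (edges G) f))

L^ : ℕ → Graph → Graph
L^ zero G = G
L^ (suc i) G = LineGraph (L^ i G)

-- number of triangles containing the edge uv = number of common neighbours
commonNbrs : (G : Graph) → Fin (n G) → Fin (n G) → ℕ
commonNbrs G u v = countFin (n G) (λ w → adj G u w ∧ adj G v w)

Triangular : ℕ → Graph → Set
Triangular k G = ∀ u v → adj G u v ≡ true → k ≤ commonNbrs G u v

-- d̃(G) = min { i : δ(L^i(G)) ≥ 3 }, as a predicate: "d is d̃(G)"
IsDtilde : Graph → ℕ → Set
IsDtilde G d = (3 ≤ δ (L^ d G)) × (∀ j → j < d → δ (L^ j G) < 3)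

{-# OPTIONS --safe #-}
-- Let H be simple. Two adjacent edges of L(H) meet in a vertex v of H, and
-- every other edge at v is adjacent to both of them; so L(H) is
-- (δ(H) − 2)-triangular. An edge ab of H meets the deg a − 1 other edges at a
-- and the deg b − 1 other edges at b, so δ(L(H)) ≥ 2δ(H) − 2, that is
-- δ(L(H)) − 2 ≥ 2(δ(H) − 2). Iterating, δ(L^i(H)) − 2 ≥ 2^i (δ(H) − 2), and
-- both parts follow, part (ii) by applying part (i) to H = L^d̃(G).
module Submission where

open import Defs
open import Data.Nat using (ℕ; zero; suc; _+_; _*_; _∸_; _^_; _≤_; _<_; z≤n; s≤s; _≡ᵇ_; _<ᵇ_)
open import Data.Nat.Properties
open import Data.Fin using (Fin; toℕ) renaming (zero to fzero; suc to fsuc)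
open import Data.Fin.Properties using (toℕ-injective; toℕ<n) renaming (suc-injective to fsuc-injective; 0≢1+n to fzero≢fsuc)
open import Data.Bool using (Bool; true; false; _∧_; _∨_; not; if_then_else_)
open import Data.Bool.Properties using (∧-conicalˡ; ∧-conicalʳ; ∨-zeroʳ; ∨-assoc; ∨-comm; ¬-not; T-≡)
open import Data.Empty using (⊥-elim)
open import Data.Sum using (_⊎_; inj₁; inj₂; [_,_]′)
import Data.Sum as Sum
open import Data.Product using (Σ; _×_; _,_; proj₁; proj₂)
open import Data.List using ([]; [_]; length; lookup; filter; tabulate; allFin)
open import Data.List.Properties using (foldr-preservesᵇ; foldr-preservesᵒ)
open import Data.List.Membership.Propositional using (_∈_; lose)
open import Data.List.Membership.Propositional.Properties using (∈-allFin; ∈-map⁺; ∈-lookup; ∈-concatMap⁺; ∈-concatMap⁻)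
open import Data.List.Relation.Unary.Any as Any using (here)
open import Data.List.Relation.Unary.Any.Properties using (lookup-index)
open import Data.List.Relation.Unary.All.Properties using (map⁺; tabulate⁺)
open import Function using (_∘_; id)
open import Function.Bundles using (Equivalence)
open import Relation.Binary using (tri<; tri≈; tri>)
open import Relation.Binary.PropositionalEquality hiding ([_])
open import Relation.Nullary using (yes; no)

∨-introˡ : ∀ {a} b → a ≡ true → a ∨ b ≡ true
∨-introˡ b refl = refl

∨-introʳ : ∀ a {b} → b ≡ true → a ∨ b ≡ true
∨-introʳ a refl = ∨-zeroʳ a

∨-elim : ∀ a {b} → a ∨ b ≡ true → a ≡ true ⊎ b ≡ true
∨-elim true  _ = inj₁ refl
∨-elim false e = inj₂ e

≡ᵇ-sym : ∀ m n → (m ≡ᵇ n) ≡ (n ≡ᵇ m)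
≡ᵇ-sym zero    zero    = refl
≡ᵇ-sym zero    (suc n) = refl
≡ᵇ-sym (suc m) zero    = refl
≡ᵇ-sym (suc m) (suc n) = ≡ᵇ-sym m n

module _ {k : ℕ} where

  ==F⇒≡ : (a b : Fin k) → (a ==F b) ≡ true → a ≡ b
  ==F⇒≡ a b e = toℕ-injective (≡ᵇ⇒≡ (toℕ a) (toℕ b) (Equivalence.from T-≡ e))

  ≡⇒==F : {a b : Fin k} → a ≡ b → (a ==F b) ≡ true
  ≡⇒==F {a} refl = Equivalence.to T-≡ (≡⇒≡ᵇ (toℕ a) (toℕ a) refl)

  ≢⇒==F≡false : {a b : Fin k} → a ≢ b → (a ==F b) ≡ false
  ≢⇒==F≡false {a} {b} a≢b with a ==F b in eq
  ... | true  = ⊥-elim (a≢b (==F⇒≡ a b eq))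
  ... | false = refl

  not==F⇒≢ : {a b : Fin k} → not (a ==F b) ≡ true → a ≢ b
  not==F⇒≢ h a≡b with trans (sym (cong not (≡⇒==F a≡b))) h
  ... | ()

  ==F-sym : (a b : Fin k) → (a ==F b) ≡ (b ==F a)
  ==F-sym a b = ≡ᵇ-sym (toℕ a) (toℕ b)

count : (k : ℕ) → (Fin k → Bool) → ℕ
count zero    p = 0
count (suc k) p = if p fzero then suc (count k (p ∘ fsuc)) else count k (p ∘ fsuc)

length-filter-tabulate : ∀ {A : Set} k (g : Fin k → A) (p : A → Bool) →
  length (filter (λ x → Data.Bool._≟_ (p x) true) (tabulate g)) ≡ count k (p ∘ g)
length-filter-tabulate zero    g p = refl
length-filter-tabulate (suc k) g p with p (g fzero)
... | true  = cong suc (length-filter-tabulate k (g ∘ fsuc) p)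
... | false = length-filter-tabulate k (g ∘ fsuc) p

countFin≡count : ∀ k p → countFin k p ≡ count k p
countFin≡count k = length-filter-tabulate k id

_⊆ᵇ_ : ∀ {k} → (Fin k → Bool) → (Fin k → Bool) → Set
p ⊆ᵇ q = ∀ x → p x ≡ true → q x ≡ true

_∖_ : ∀ {k} → (Fin k → Bool) → Fin k → Fin k → Bool
(p ∖ y) x = p x ∧ not (x ==F y)

∈∖⇒ : ∀ {k} (p : Fin k → Bool) y {x} → (p ∖ y) x ≡ true → p x ≡ true × x ≢ y
∈∖⇒ p y h = ∧-conicalˡ _ _ h , not==F⇒≢ (∧-conicalʳ _ _ h)

count-mono : ∀ {k} {p q : Fin k → Bool} → p ⊆ᵇ q → count k p ≤ count k q
count-mono {zero}              p⊆q = z≤n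
count-mono {suc k} {p} {q} p⊆q with p fzero in ep | q fzero in eq
... | true  | true  = s≤s (count-mono (p⊆q ∘ fsuc))
... | true  | false with trans (sym (p⊆q fzero ep)) eq
...   | ()
count-mono {suc k} p⊆q | false | true  = m≤n⇒m≤1+n (count-mono (p⊆q ∘ fsuc))
count-mono {suc k} p⊆q | false | false = count-mono (p⊆q ∘ fsuc)

count≤suc-count∖ : ∀ {k} (p : Fin k → Bool) y → count k p ≤ suc (count k (p ∖ y))
count≤suc-count∖ {suc k} p fzero with p fzero
... | true  = s≤s (count-mono {p = p ∘ fsuc} (λ _ px → cong (_∧ true) px))
... | false = m≤n⇒m≤1+n (count-mono {p = p ∘ fsuc} (λ _ px → cong (_∧ true) px))
count≤suc-count∖ {suc k} p (fsuc y) with p fzero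
... | true  = s≤s (count≤suc-count∖ (p ∘ fsuc) y)
... | false = count≤suc-count∖ (p ∘ fsuc) y

suc-count∖≤count : ∀ {k} (p : Fin k → Bool) {y} → p y ≡ true → suc (count k (p ∖ y)) ≤ count k p
suc-count∖≤count {suc k} p {fzero} py rewrite py =
  s≤s (count-mono {q = p ∘ fsuc} (λ _ h → ∧-conicalˡ _ _ h))
suc-count∖≤count {suc k} p {fsuc y} py with p fzero
... | true  = s≤s (suc-count∖≤count (p ∘ fsuc) py)
... | false = suc-count∖≤count (p ∘ fsuc) py

count-injection : ∀ {j k} {p : Fin j → Bool} {q : Fin k → Bool}
  (f : ∀ x → p x ≡ true → Fin k) → (∀ x px → q (f x px) ≡ true) →
  (∀ x y px py → f x px ≡ f y py → x ≡ y) → count j p ≤ count k q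
count-injection {zero}          f hit inj = z≤n
count-injection {suc j} {p = p} {q} f hit inj with p fzero in p0
... | false = count-injection (f ∘ fsuc) (hit ∘ fsuc) (λ x y px py → fsuc-injective ∘ inj _ _ px py)
... | true  =
  ≤-trans (s≤s (count-injection (f ∘ fsuc) avoids-f₀ (λ x y px py → fsuc-injective ∘ inj _ _ px py)))
          (suc-count∖≤count q (hit fzero p0))
  where
  avoids-f₀ : ∀ x px → (q ∖ f fzero p0) (f (fsuc x) px) ≡ true
  avoids-f₀ x px = cong₂ _∧_ (hit (fsuc x) px)
    (cong not (≢⇒==F≡false (λ same → fzero≢fsuc (sym (inj _ _ px p0 same)))))

count-split : ∀ {k} (p s : Fin k → Bool) →
  count k (λ x → p x ∧ s x) + count k (λ x → p x ∧ not (s x)) ≡ count k p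
count-split {zero}  p s = refl
count-split {suc k} p s with p fzero | s fzero
... | true  | true  = cong suc (count-split (p ∘ fsuc) (s ∘ fsuc))
... | true  | false = trans (+-suc _ _) (cong suc (count-split (p ∘ fsuc) (s ∘ fsuc)))
... | false | _     = count-split (p ∘ fsuc) (s ∘ fsuc)

count-witness : ∀ {k} (p : Fin k → Bool) → 1 ≤ count k p → Σ (Fin k) λ x → p x ≡ true
count-witness {suc k} p h with p fzero in p0
... | true  = fzero , p0
... | false with count-witness (p ∘ fsuc) h
...   | x , px = fsuc x , px

δ≤degree : ∀ G v → δ G ≤ degree G v
δ≤degree (graph (suc k) a) v =
  foldr-preservesᵒ (λ x y → [ m≤n⇒m⊓o≤n y , m≤n⇒o⊓m≤n x ]′) _ _
    (inj₂ (Any.map (≤-reflexive ∘ sym) (∈-map⁺ _ (∈-allFin v))))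

≤δ : ∀ G {c} → 1 ≤ n G → (∀ v → c ≤ degree G v) → c ≤ δ G
≤δ (graph (suc k) a) _ c≤deg =
  foldr-preservesᵇ {P = _ ≤_} ⊓-glb (c≤deg fzero) (map⁺ (tabulate⁺ c≤deg))

δ-vertex : ∀ G → 1 ≤ δ G → Fin (n G)
δ-vertex (graph (suc k) a) _ = fzero

δ≤count : ∀ G v → δ G ≤ count (n G) (adj G v)
δ≤count G v = subst (δ G ≤_) (countFin≡count (n G) (adj G v)) (δ≤degree G v)

δ∸1≤count∖ : ∀ G v x → δ G ∸ 1 ≤ count (n G) (adj G v ∖ x)
δ∸1≤count∖ G v x = m≤n+o⇒m∸n≤o (δ G) 1 (≤-trans (δ≤count G v) (count≤suc-count∖ _ x))

δ∸2≤count∖∖ : ∀ G v x y → δ G ∸ 2 ≤ count (n G) ((adj G v ∖ x) ∖ y)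
δ∸2≤count∖∖ G v x y = m≤n+o⇒m∸n≤o (δ G) 2
  (≤-trans (δ≤count G v) (≤-trans (count≤suc-count∖ _ x) (s≤s (count≤suc-count∖ _ y))))

∈-if-singleton : ∀ {A : Set} c {x y : A} → y ∈ (if c then [ x ] else []) → c ≡ true × y ≡ x
∈-if-singleton true (here refl) = refl , refl

edges-complete : ∀ G {i j} → toℕ i < toℕ j → adj G i j ≡ true → (i , j) ∈ edges G
edges-complete G {i} {j} i<j ij =
  ∈-concatMap⁺ _ (lose (∈-allFin i) (∈-concatMap⁺ _ (lose (∈-allFin j) ij∈)))
  where
  ij∈ : (i , j) ∈ (if (toℕ i <ᵇ toℕ j) ∧ adj G i j then [ (i , j) ] else [])
  ij∈ rewrite Equivalence.to T-≡ (<⇒<ᵇ i<j) | ij = here refl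

edges-ordered : ∀ G {e} → e ∈ edges G → toℕ (proj₁ e) < toℕ (proj₂ e)
edges-ordered G {e} e∈ with Any.satisfied (∈-concatMap⁻ _ {xs = allFin (n G)} e∈)
... | i , e∈ᵢ with Any.satisfied (∈-concatMap⁻ _ {xs = allFin (n G)} e∈ᵢ)
...   | j , e∈ᵢⱼ with ∈-if-singleton ((toℕ i <ᵇ toℕ j) ∧ adj G i j) {i , j} e∈ᵢⱼ
...     | guard , refl = <ᵇ⇒< (toℕ i) (toℕ j) (Equivalence.from T-≡ (∧-conicalˡ _ _ guard))

Joins : ∀ {k} → Fin k × Fin k → Fin k → Fin k → Set
Joins e v w = e ≡ (v , w) ⊎ e ≡ (w , v)

joins-unique : ∀ {k} {e : Fin k × Fin k} {v w w′} → Joins e v w → Joins e v w′ → w ≡ w′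
joins-unique (inj₁ refl) (inj₁ refl) = refl
joins-unique (inj₁ refl) (inj₂ refl) = refl
joins-unique (inj₂ refl) (inj₁ refl) = refl
joins-unique (inj₂ refl) (inj₂ refl) = refl

incident : ∀ {k} → Fin k → Fin k × Fin k → Bool
incident v (a , b) = (v ==F a) ∨ (v ==F b)

incident⇒≡ : ∀ {k} (v : Fin k) e → incident v e ≡ true → v ≡ proj₁ e ⊎ v ≡ proj₂ e
incident⇒≡ v (a , b) ve = Sum.map (==F⇒≡ v a) (==F⇒≡ v b) (∨-elim (v ==F a) ve)

joins⇒incident : ∀ {k} {e : Fin k × Fin k} {v w} → Joins e v w → incident v e ≡ true
joins⇒incident {v = v} {w} (inj₁ refl) = ∨-introˡ (v ==F w) (≡⇒==F {a = v} refl)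
joins⇒incident {v = v} {w} (inj₂ refl) = ∨-introʳ (v ==F w) (≡⇒==F {a = v} refl)

incident⇒joins : ∀ {k} {v : Fin k} e → incident v e ≡ true → Σ (Fin k) (Joins e v)
incident⇒joins {v = v} (a , b) ve with incident⇒≡ v (a , b) ve
... | inj₁ refl = b , inj₁ refl
... | inj₂ refl = a , inj₂ refl

incident-joins⇒≡ : ∀ {k} {e : Fin k × Fin k} {u v w} → Joins e v w → incident u e ≡ true → u ≡ v ⊎ u ≡ w
incident-joins⇒≡ {u = u} (inj₁ refl) ue = incident⇒≡ u _ ue
incident-joins⇒≡ {u = u} (inj₂ refl) ue = Sum.swap (incident⇒≡ u _ ue)

share-split : ∀ {k} (a b : Fin k) f → share (a , b) f ≡ incident a f ∨ incident b f
share-split a b (c , d) = sym (∨-assoc (a ==F c) (a ==F d) _)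

share-incident : ∀ {k} {v : Fin k} e f → incident v e ≡ true → incident v f ≡ true → share e f ≡ true
share-incident {v = v} (a , b) f ve vf with incident⇒≡ v (a , b) ve
... | inj₁ refl = trans (share-split v b f) (∨-introˡ (incident b f) vf)
... | inj₂ refl = trans (share-split a v f) (∨-introʳ (incident a f) vf)

share⇒incident : ∀ {k} (e f : Fin k × Fin k) → share e f ≡ true →
  Σ (Fin k) λ v → incident v e ≡ true × incident v f ≡ true
share⇒incident (a , b) f s with ∨-elim (incident a f) (trans (sym (share-split a b f)) s)
... | inj₁ af = a , joins⇒incident {v = a} {b} (inj₁ refl) , af
... | inj₂ bf = b , joins⇒incident {v = b} {a} (inj₂ refl) , bf

share-sym : ∀ {k} (e f : Fin k × Fin k) → share e f ≡ share f e
share-sym (a , b) (c , d)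
  rewrite ==F-sym c a | ==F-sym c b | ==F-sym d a | ==F-sym d b =
  cong ((a ==F c) ∨_) (trans (sym (∨-assoc (a ==F d) (b ==F c) _))
                     (trans (cong (_∨ (b ==F d)) (∨-comm (a ==F d) (b ==F c)))
                            (∨-assoc (b ==F c) (a ==F d) _)))

line-simple : ∀ H → IsSimple (LineGraph H)
line-simple H =
  (λ e f → cong₂ _∧_ (cong not (==F-sym e f)) (share-sym (lookup (edges H) e) (lookup (edges H) f))) ,
  (λ e → cong (λ b → not b ∧ share (lookup (edges H) e) (lookup (edges H) e)) (≡⇒==F {a = e} refl))

module _ (H : Graph) (simple : IsSimple H) where

  private
    ends : Fin (n (LineGraph H)) → Fin (n H) × Fin (n H)
    ends = lookup (edges H)

  no-loops : ∀ {v w} → adj H v w ≡ true → v ≢ w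
  no-loops {v} vv refl with trans (sym (proj₂ simple v)) vv
  ... | ()

  edgeOf : ∀ {v w} → adj H v w ≡ true → Σ (Fin (n (LineGraph H))) λ e → Joins (ends e) v w
  edgeOf {v} {w} vw with <-cmp (toℕ v) (toℕ w)
  ... | tri< v<w _ _ = let p = edges-complete H v<w vw in Any.index p , inj₁ (sym (lookup-index p))
  ... | tri≈ _ v≡w _ = ⊥-elim (no-loops vw (toℕ-injective v≡w))
  ... | tri> _ _ w<v = let p = edges-complete H w<v (trans (proj₁ simple w v) vw)
                       in Any.index p , inj₂ (sym (lookup-index p))

  edgeOf-injective : ∀ {v w w′} (vw : adj H v w ≡ true) (vw′ : adj H v w′ ≡ true) →
    proj₁ (edgeOf vw) ≡ proj₁ (edgeOf vw′) → w ≡ w′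
  edgeOf-injective vw vw′ same =
    joins-unique (subst (λ e → Joins (ends e) _ _) same (proj₂ (edgeOf vw))) (proj₂ (edgeOf vw′))

  edgeOf-adjacent : ∀ {e v x w} → Joins (ends e) v x → (vw : adj H v w ≡ true) → w ≢ x →
    adj (LineGraph H) e (proj₁ (edgeOf vw)) ≡ true
  edgeOf-adjacent {e} {v} e-vx vw w≢x =
    cong₂ _∧_ (cong not (≢⇒==F≡false e≢g))
              (share-incident {v = v} (ends e) (ends g) (joins⇒incident e-vx) (joins⇒incident g-vw))
    where
    g = proj₁ (edgeOf vw)
    g-vw = proj₂ (edgeOf vw)
    e≢g : e ≢ g
    e≢g e≡g = w≢x (joins-unique g-vw (subst (λ f → Joins (ends f) _ _) e≡g e-vx))

  count≤count-edgeOf : ∀ {v} (p : Fin (n H) → Bool) (q : Fin (n (LineGraph H)) → Bool)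
    (p⊆N : p ⊆ᵇ adj H v) →
    (∀ w pw → q (proj₁ (edgeOf (p⊆N w pw))) ≡ true) → count _ p ≤ count _ q
  count≤count-edgeOf p q p⊆N hit =
    count-injection (λ w pw → proj₁ (edgeOf (p⊆N w pw))) hit
                    (λ w w′ pw pw′ → edgeOf-injective (p⊆N w pw) (p⊆N w′ pw′))

  line-triangular : Triangular (δ H ∸ 2) (LineGraph H)
  line-triangular e f ef with share⇒incident (ends e) (ends f) (∧-conicalʳ _ _ ef)
  ... | v , ve , vf with incident⇒joins (ends e) ve | incident⇒joins (ends f) vf
  ...   | x , e-vx | y , f-vy = begin
    δ H ∸ 2                                 ≤⟨ δ∸2≤count∖∖ H v x y ⟩
    count _ ((adj H v ∖ x) ∖ y)             ≤⟨ count≤count-edgeOf _ _ p⊆N common ⟩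
    count _ (λ g → adj L e g ∧ adj L f g)   ≡⟨ countFin≡count _ (λ g → adj L e g ∧ adj L f g) ⟨
    commonNbrs L e f                        ∎
    where
    open ≤-Reasoning
    L = LineGraph H
    p⊆N : ((adj H v ∖ x) ∖ y) ⊆ᵇ adj H v
    p⊆N w h = proj₁ (∈∖⇒ (adj H v) x (proj₁ (∈∖⇒ (adj H v ∖ x) y h)))
    common : ∀ w h → let g = proj₁ (edgeOf (p⊆N w h)) in (adj L e g ∧ adj L f g) ≡ true
    common w h = cong₂ _∧_
      (edgeOf-adjacent e-vx (p⊆N w h) (proj₂ (∈∖⇒ (adj H v) x (proj₁ (∈∖⇒ (adj H v ∖ x) y h)))))
      (edgeOf-adjacent f-vy (p⊆N w h) (proj₂ (∈∖⇒ (adj H v ∖ x) y h)))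

  line-degree : ∀ e → 2 * (δ H ∸ 1) ≤ degree (LineGraph H) e
  line-degree e = begin
    2 * (δ H ∸ 1)                               ≤⟨ +-mono-≤ (δ∸1≤count∖ H a b)
                                                            (+-monoˡ-≤ 0 (δ∸1≤count∖ H b a)) ⟩
    count _ (adj H a ∖ b) + (count _ (adj H b ∖ a) + 0)
                                                ≡⟨ cong (count _ (adj H a ∖ b) +_) (+-identityʳ _) ⟩
    count _ (adj H a ∖ b) + count _ (adj H b ∖ a)
                                                ≤⟨ +-mono-≤ (count≤count-edgeOf _ _ (N∖ a b) at-a)
                                                            (count≤count-edgeOf _ _ (N∖ b a) at-b) ⟩
    count _ (λ g → adj L e g ∧ incident a (ends g))
      + count _ (λ g → adj L e g ∧ not (incident a (ends g)))
                                                ≡⟨ count-split (adj L e) (incident a ∘ ends) ⟩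
    count _ (adj L e)                           ≡⟨ countFin≡count _ (adj L e) ⟨
    degree L e                                  ∎
    where
    open ≤-Reasoning
    L = LineGraph H
    a = proj₁ (ends e)
    b = proj₂ (ends e)
    a≢b : a ≢ b
    a≢b a≡b = <-irrefl (cong toℕ a≡b) (edges-ordered H (∈-lookup e))
    N∖ : ∀ v x → (adj H v ∖ x) ⊆ᵇ adj H v
    N∖ v x w h = proj₁ (∈∖⇒ (adj H v) x h)
    at-a : ∀ w h → let g = proj₁ (edgeOf (N∖ a b w h)) in (adj L e g ∧ incident a (ends g)) ≡ true
    at-a w h = cong₂ _∧_ (edgeOf-adjacent (inj₁ refl) (N∖ a b w h) (proj₂ (∈∖⇒ (adj H a) b h)))
                         (joins⇒incident (proj₂ (edgeOf (N∖ a b w h))))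
    at-b : ∀ w h → let g = proj₁ (edgeOf (N∖ b a w h)) in (adj L e g ∧ not (incident a (ends g))) ≡ true
    at-b w h = cong₂ _∧_ (edgeOf-adjacent (inj₂ refl) bw w≢a) (cong not (¬-not a∉g))
      where
      bw = N∖ b a w h
      w≢a = proj₂ (∈∖⇒ (adj H b) a h)
      a∉g : incident a (ends (proj₁ (edgeOf bw))) ≢ true
      a∉g ag = [ a≢b , w≢a ∘ sym ]′ (incident-joins⇒≡ (proj₂ (edgeOf bw)) ag)

  line-nonempty : 1 ≤ δ H → 1 ≤ n (LineGraph H)
  line-nonempty δ≥1 = ≤-trans (s≤s z≤n) (toℕ<n (proj₁ (edgeOf (proj₂ nbr))))
    where
    v = δ-vertex H δ≥1
    nbr = count-witness (adj H v) (≤-trans δ≥1 (δ≤count H v))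

  δ-line : 2 * (δ H ∸ 1) ≤ δ (LineGraph H)
  δ-line with 1 ≤? δ H
  ... | yes δ≥1 = ≤δ (LineGraph H) (line-nonempty δ≥1) line-degree
  ... | no  δ≱1 =
    subst (λ d → 2 * d ≤ δ (LineGraph H)) (sym (m≤n⇒m∸n≡0 (<⇒≤ (≰⇒> δ≱1)))) z≤n

L^-simple : ∀ {H} → IsSimple H → ∀ i → IsSimple (L^ i H)
L^-simple simple zero    = simple
L^-simple {H} simple (suc i) = line-simple (L^ i H)

L^-+ : ∀ d i G → L^ (d + i) G ≡ L^ i (L^ d G)
L^-+ d zero    G = cong (λ j → L^ j G) (+-identityʳ d)
L^-+ d (suc i) G = trans (cong (λ j → L^ j G) (+-suc d i)) (cong LineGraph (L^-+ d i G))

2*[m∸2]≡2*[m∸1]∸2 : ∀ m → 2 * (m ∸ 2) ≡ 2 * (m ∸ 1) ∸ 2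
2*[m∸2]≡2*[m∸1]∸2 m = trans (cong (2 *_) (sym (∸-+-assoc m 1 1))) (*-distribˡ-∸ 2 (m ∸ 1) 1)

δ-L^ : ∀ {H} → IsSimple H → ∀ i → 2 ^ i * (δ H ∸ 2) ≤ δ (L^ i H) ∸ 2
δ-L^ simple zero = ≤-reflexive (*-identityˡ _)
δ-L^ {H} simple (suc i) = begin
  2 ^ suc i * (δ H ∸ 2)        ≡⟨ *-assoc 2 (2 ^ i) _ ⟩
  2 * (2 ^ i * (δ H ∸ 2))      ≤⟨ *-monoʳ-≤ 2 (δ-L^ simple i) ⟩
  2 * (δ (L^ i H) ∸ 2)         ≡⟨ 2*[m∸2]≡2*[m∸1]∸2 (δ (L^ i H)) ⟩
  2 * (δ (L^ i H) ∸ 1) ∸ 2     ≤⟨ ∸-monoˡ-≤ 2 (δ-line (L^ i H) (L^-simple simple i)) ⟩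
  δ (L^ (suc i) H) ∸ 2         ∎
  where open ≤-Reasoning

Triangular-mono : ∀ {k k′ G} → k ≤ k′ → Triangular k′ G → Triangular k G
Triangular-mono k≤k′ t u v uv = ≤-trans k≤k′ (t u v uv)

L^-triangular : ∀ {H} → IsSimple H → ∀ i → Triangular (2 ^ i * (δ H ∸ 2)) (L^ (suc i) H)
L^-triangular {H} simple i =
  Triangular-mono (δ-L^ simple i) (line-triangular (L^ i H) (L^-simple simple i))

-- Membership in 𝒢 only guarantees that d̃(G) exists, which IsDtilde G d
-- already provides: the bounds hold for every simple graph.
lemma3p4 : (G : Graph) → IsSimple G → In𝒢 G → (i : ℕ) → 1 ≤ i →
    (3 ≤ δ G → Triangular (2 ^ (i ∸ 1) * (δ G ∸ 2)) (L^ i G))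
    × (δ G ≤ 2 → (d : ℕ) → IsDtilde G d →
        Triangular (2 ^ (i ∸ 1) * (δ (L^ d G) ∸ 2)) (L^ (d + i) G)
        × Triangular (2 ^ (i ∸ 1)) (L^ (d + i) G))
lemma3p4 G simple _ (suc i) (s≤s z≤n) = (λ _ → L^-triangular simple i) , after-d̃
  where
  after-d̃ : δ G ≤ 2 → (d : ℕ) → IsDtilde G d →
    Triangular (2 ^ i * (δ (L^ d G) ∸ 2)) (L^ (d + suc i) G) × Triangular (2 ^ i) (L^ (d + suc i) G)
  after-d̃ _ d (δ₀≥3 , _) = triangular , Triangular-mono 2^i≤ triangular
    where
    triangular : Triangular (2 ^ i * (δ (L^ d G) ∸ 2)) (L^ (d + suc i) G)
    triangular = subst (Triangular _) (sym (L^-+ d (suc i) G)) (L^-triangular (L^-simple simple d) i)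
    2^i≤ : 2 ^ i ≤ 2 ^ i * (δ (L^ d G) ∸ 2)
    2^i≤ = subst (_≤ 2 ^ i * (δ (L^ d G) ∸ 2)) (*-identityʳ (2 ^ i))
                 (*-monoʳ-≤ (2 ^ i) (∸-monoˡ-≤ 2 δ₀≥3))
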